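{- Let $M=(I_r\,|\,B)\in\mathbb{Z}^{r\times m}$ be simple. Then for some positive integers $t,k$ there exists $\Psi\in\mathbb{Z}^{m\times t}$ such that for every abelian group $G$, the homomorphism $\Psi:G^t\to G^m$, $x\mapsto\Psi x$, is a $(t,m,k)$-representation for $(M,G)$ (with $G_*=G$).
   Context: $M=(I_r|B)$ is simple if $m\ge r+2$ and for each $i\in[r]$ the $i$-th row $B_i$ of $B$ is nonzero with gcd of its entries equal to $1$. $\ker_G M=\{x\in G^m:Mx=0\}$. For $e\subset[t]$, $\gamma_e:G^e\to G^t$ inserts zeros outside $e$, $p_e$ is coordinate projection. For $\Psi:G_*^t\to G^m$, $\psi_j=p_j\circ\Psi$, $\mathrm{supp}\,\psi_j=\{i:\psi_j\circ\gamma_{\{i\}}\ne0\}$. A $(t,m,k)$-representation of $(M,G)$ is a homomorphism $\Psi:G_*^t\to G^m$, $G_*$ abelian, with: (i) distinct $k$-subsets $C_1,\dots,C_m$ of $[t]$ with $\mathrm{supp}\,\psi_j\subset C_j$; (ii) $\Psi(G_*^t)=\ker_G M$; (iii) $p_{C_j}(\ker_{G_*}\Psi)=\ker_{G_*}(\psi_j\circ\gamma_{C_j})$ for each $j$; when $G$ is second-countable compact, also $G_*$ second-countable compact and $\Psi$ continuous. -}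

module Defs where

open import Level using (Level; _⊔_; Setω) renaming (suc to lsuc)
open import Data.Nat using (ℕ; zero; suc; _+_; _≤_)
open import Data.Nat.GCD using (gcd)
open import Data.Integer using (ℤ; +_; -[1+_]) renaming (∣_∣ to abs)
open import Data.Fin using (Fin; zero; suc; splitAt; _≟_)
open import Data.Fin.Subset using (Subset; _∈_; _∉_; ∣_∣)
open import Data.Vec using (lookup)
open import Data.Bool using (Bool; true; false; if_then_else_)
open import Data.Sum using (_⊎_; inj₁; inj₂)
open import Data.Product using (Σ; _×_; _,_; ∃)
open import Relation.Nullary using (¬_; does)
open import Relation.Binary.PropositionalEquality using (_≡_)
open import Algebra.Bundles using (AbelianGroup)

ZMatrix : ℕ → ℕ → Set
ZMatrix r m = Fin r → Fin m → ℤ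

gcdRow : ∀ {n} → (Fin n → ℤ) → ℕ
gcdRow {zero}  v = 0
gcdRow {suc n} v = gcd (abs (v zero)) (gcdRow (λ i → v (suc i)))

augment : ∀ r n → ZMatrix r n → ZMatrix r (r + n)
augment r n B i j with splitAt r j
... | inj₁ i' = if does (i ≟ i') then + 1 else + 0
... | inj₂ l  = B i l

record IsSimple (r n : ℕ) (B : ZMatrix r n) : Set where
  field
    cols    : 2 ≤ n
    nonzero : ∀ i → ¬ (∀ l → B i l ≡ + 0)
    gcd1    : ∀ i → gcdRow (B i) ≡ 1

module _ {c ℓ : Level} (G : AbelianGroup c ℓ) where
  open AbelianGroup G renaming (Carrier to A)

  natMul : ℕ → A → A
  natMul zero    x = ε
  natMul (suc k) x = x ∙ natMul k x

  intMul : ℤ → A → A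
  intMul (+ k)     x = natMul k x
  intMul -[1+ k ]  x = (natMul (suc k) x) ⁻¹

  sumG : ∀ {n} → (Fin n → A) → A
  sumG {zero}  f = ε
  sumG {suc n} f = f zero ∙ sumG (λ i → f (suc i))

  apply : ∀ {m t} → ZMatrix m t → (Fin t → A) → (Fin m → A)
  apply Ψ x j = sumG (λ i → intMul (Ψ j i) (x i))

  _≋_ : ∀ {n} → (Fin n → A) → (Fin n → A) → Set ℓ
  x ≋ y = ∀ i → x i ≈ y i

  IsZero : ∀ {n} → (Fin n → A) → Set ℓ
  IsZero x = ∀ i → x i ≈ ε

  γ₁ : ∀ {t} → Fin t → A → (Fin t → A)
  γ₁ i g i' = if does (i' ≟ i) then g else ε

  -- γ_C : G^C → G^t.  An element of G^C is represented by a function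
  -- z : Fin t → A of which only the values on C matter.
  γ : ∀ {t} → Subset t → (Fin t → A) → (Fin t → A)
  γ C z i = if lookup C i then z i else ε

  InSupp : ∀ {m t} → ZMatrix m t → Fin m → Fin t → Set (c ⊔ ℓ)
  InSupp Ψ j i = ¬ (∀ g → apply Ψ (γ₁ i g) j ≈ ε)

  record IsRepresentation {r m : ℕ} (M : ZMatrix r m) (t k : ℕ)
                          (Ψ : ZMatrix m t) : Set (lsuc (c ⊔ ℓ)) where
    field
      C        : Fin m → Subset t
      C-size   : ∀ j → ∣ C j ∣ ≡ k
      C-inj    : ∀ j j' → C j ≡ C j' → j ≡ j'
      supp⊆C   : ∀ j i → InSupp Ψ j i → i ∈ C j
      image⊆ker : ∀ x → IsZero (apply M (apply Ψ x))
      ker⊆image : ∀ y → IsZero (apply M y) → ∃ λ x → apply Ψ x ≋ y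
      proj⊆ker : ∀ j x → IsZero (apply Ψ x) → apply Ψ (γ (C j) x) j ≈ ε
      ker⊆proj : ∀ j (z : Fin t → A) → apply Ψ (γ (C j) z) j ≈ ε →
                 ∃ λ x → IsZero (apply Ψ x) × (∀ i → i ∈ C j → x i ≈ z i)

record HasUniformRepresentation {r m : ℕ} (M : ZMatrix r m) : Setω where
  field
    t     : ℕ
    k     : ℕ
    t-pos : 1 ≤ t
    k-pos : 1 ≤ k
    Ψ     : ZMatrix m t
    rep   : ∀ {c ℓ} (G : AbelianGroup c ℓ) → IsRepresentation G M t k Ψ

-- Over every abelian group, ker (I_r | B) is the image of N = (−B ; I_n).  Let G^t have
-- coordinates x_l (l < n) and y_jab (j < m, a, b < n) and put
--   P(x, y)_b = x_b + Σ_j Σ_a N_ja (y_jab − y_jba),   Ψ = N ∘ P.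
-- P is onto, so Ψ(G^t) = N(G^n) = ker M.  The coefficient of y_j'ab in ψ_j is the minor
-- N_jb N_j'a − N_ja N_j'b, which vanishes for j' = j; hence C_j := all coordinates except
-- the block y_j contains supp ψ_j, and the C_j are distinct of the same size.  If z
-- vanishes off C_j and ψ_j(z) = N_j · v = 0, where v = P(z), then filling the block y_j
-- with y_jab = c_b v_a, for a Bézout vector c of the row N_j (Σ_a N_ja c_a = 1, from
-- gcd = 1), adds c_b (N_j · v) − v_b = −v_b to P, so the completed vector lies in ker Ψ.

module Submission where

open import Defs
open import Data.Nat using (ℕ; zero; suc; _+_; _∸_)

open import Level using (Level; _⊔_)
import Data.Nat as ℕ
import Data.Nat.Properties as ℕ
open import Data.Nat.GCD using (gcd; gcd-GCD; module Bézout)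
open import Data.Integer as ℤ using (ℤ; +_; -[1+_]; _⊖_) renaming (∣_∣ to abs)
import Data.Integer.Properties as ℤ
open import Data.Integer.Tactic.RingSolver using (solve-∀)
open import Algebra.Properties.Semiring.Sum ℤ.+-*-semiring using (sum; sum-cong-≗; *-distribˡ-sum)
open import Data.Fin as Fin using (Fin; zero; suc; _↑ˡ_; _↑ʳ_; combine; remQuot; splitAt)
import Data.Fin.Properties as Fin
open import Data.Fin.Subset using (Subset; _∈_; ∣_∣; ⊤; ⁅_⁆; ∁)
open import Data.Fin.Subset.Properties using (∣⊤∣≡n; ∣⁅x⁆∣≡1; ∣∁p∣≡n∸∣p∣)
open import Data.Vec using (lookup; tabulate)
open import Data.Vec.Properties
  using (lookup∘tabulate; tabulate∘lookup; tabulate-cong; lookup-replicate; lookup-map; []=⇒lookup; lookup⇒[]=)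
open import Data.Bool using (Bool; true; false; not; if_then_else_)
open import Data.Sum using (inj₁; inj₂; [_,_]′)
open import Data.Product using (_×_; _,_; ∃; ∃₂; proj₁; proj₂)
open import Data.Empty using (⊥-elim)
open import Function using (_∘_; case_of_)
open import Relation.Nullary using (yes; no; does)
open import Relation.Nullary.Decidable using (dec-true; dec-false)
open import Relation.Binary.PropositionalEquality as ≡ using (_≡_; _≢_; _≗_)
open import Algebra.Bundles using (AbelianGroup)

δ : ∀ {k} → Fin k → Fin k → ℤ
δ i j = if does (i Fin.≟ j) then + 1 else + 0

δ-diag : ∀ {k} (i : Fin k) → δ i i ≡ + 1
δ-diag i = ≡.cong (if_then + 1 else + 0) (dec-true (i Fin.≟ i) ≡.refl)

δ-off : ∀ {k} {i j : Fin k} → i ≢ j → δ i j ≡ + 0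
δ-off {i = i} {j} i≢j = ≡.cong (if_then + 1 else + 0) (dec-false (i Fin.≟ j) i≢j)

not-does-≟⇒≡ : ∀ {k} {i j : Fin k} → not (does (i Fin.≟ j)) ≡ false → i ≡ j
not-does-≟⇒≡ {i = i} {j} e with i Fin.≟ j
... | yes i≡j = i≡j

toℤ-identity : ∀ d y b x a → d ℕ.+ y ℕ.* b ≡ x ℕ.* a → + x ℤ.* + a ≡ + d ℤ.+ + y ℤ.* + b
toℤ-identity d y b x a eq = begin
  + x ℤ.* + a             ≡⟨ ℤ.pos-* x a ⟨
  + (x ℕ.* a)             ≡⟨ ≡.cong +_ eq ⟨
  + (d ℕ.+ y ℕ.* b)       ≡⟨ ℤ.pos-+ d (y ℕ.* b) ⟩
  + d ℤ.+ + (y ℕ.* b)     ≡⟨ ≡.cong (λ s → + d ℤ.+ s) (ℤ.pos-* y b) ⟩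
  + d ℤ.+ + y ℤ.* + b     ∎
  where open ≡.≡-Reasoning

bezout : ∀ a b → ∃₂ λ x y → x ℤ.* + a ℤ.+ y ℤ.* + b ≡ + gcd a b
bezout a b with Bézout.identity (gcd-GCD a b)
... | Bézout.+- x y eq = + x , ℤ.- + y , (begin
  + x ℤ.* + a ℤ.+ ℤ.- + y ℤ.* + b                 ≡⟨ ≡.cong (λ s → s ℤ.+ ℤ.- + y ℤ.* + b) (toℤ-identity _ y b x a eq) ⟩
  + gcd a b ℤ.+ + y ℤ.* + b ℤ.+ ℤ.- + y ℤ.* + b   ≡⟨ cancel (+ gcd a b) (+ y) (+ b) ⟩
  + gcd a b                                       ∎)
  where
  open ≡.≡-Reasoning
  cancel : ∀ d y b → d ℤ.+ y ℤ.* b ℤ.+ ℤ.- y ℤ.* b ≡ d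
  cancel = solve-∀
... | Bézout.-+ x y eq = ℤ.- + x , + y , (begin
  ℤ.- + x ℤ.* + a ℤ.+ + y ℤ.* + b                  ≡⟨ ≡.cong (λ s → ℤ.- + x ℤ.* + a ℤ.+ s) (toℤ-identity _ x a y b eq) ⟩
  ℤ.- + x ℤ.* + a ℤ.+ (+ gcd a b ℤ.+ + x ℤ.* + a)  ≡⟨ cancel (+ gcd a b) (+ x) (+ a) ⟩
  + gcd a b                                        ∎)
  where
  open ≡.≡-Reasoning
  cancel : ∀ d x a → ℤ.- x ℤ.* a ℤ.+ (d ℤ.+ x ℤ.* a) ≡ d
  cancel = solve-∀

sgn : ℤ → ℤ
sgn (+ _)    = + 1
sgn -[1+ _ ] = -[1+ 0 ]

sgn-* : ∀ v → sgn v ℤ.* v ≡ + abs v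
sgn-* (+ k)    = ℤ.*-identityˡ (+ k)
sgn-* -[1+ k ] = ℤ.-1*i≡-i -[1+ k ]

gcdRow-bezout : ∀ {n} (v : Fin n → ℤ) → ∃ λ (c : Fin n → ℤ) → sum (λ i → c i ℤ.* v i) ≡ + gcdRow v
gcdRow-bezout {zero}  v = (λ ()) , ≡.refl
gcdRow-bezout {suc n} v with gcdRow-bezout (λ i → v (suc i)) | bezout (abs (v zero)) (gcdRow (λ i → v (suc i)))
... | c , c·v≡g | x , y , bez = coeffs , (begin
  x ℤ.* sgn (v zero) ℤ.* v zero ℤ.+ sum (λ i → y ℤ.* c i ℤ.* v (suc i))
    ≡⟨ ≡.cong₂ ℤ._+_ (ℤ.*-assoc x _ _) (sum-cong-≗ (λ i → ℤ.*-assoc y (c i) (v (suc i)))) ⟩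
  x ℤ.* (sgn (v zero) ℤ.* v zero) ℤ.+ sum (λ i → y ℤ.* (c i ℤ.* v (suc i)))
    ≡⟨ ≡.cong₂ ℤ._+_ (≡.cong (x ℤ.*_) (sgn-* (v zero))) (≡.sym (*-distribˡ-sum y (λ i → c i ℤ.* v (suc i)))) ⟩
  x ℤ.* + abs (v zero) ℤ.+ y ℤ.* sum (λ i → c i ℤ.* v (suc i))
    ≡⟨ ≡.cong (λ s → x ℤ.* + abs (v zero) ℤ.+ y ℤ.* s) c·v≡g ⟩
  x ℤ.* + abs (v zero) ℤ.+ y ℤ.* + gcdRow (λ i → v (suc i))
    ≡⟨ bez ⟩
  + gcdRow v ∎)
  where
  open ≡.≡-Reasoning
  coeffs : Fin (suc n) → ℤ
  coeffs zero    = x ℤ.* sgn (v zero)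
  coeffs (suc i) = y ℤ.* c i

∣tabulate∣-↑ : ∀ p {q} (f : Fin (p ℕ.+ q) → Bool) →
               ∣ tabulate f ∣ ≡ ∣ tabulate (f ∘ (_↑ˡ q)) ∣ ℕ.+ ∣ tabulate (f ∘ (p ↑ʳ_)) ∣
∣tabulate∣-↑ zero    f = ≡.refl
∣tabulate∣-↑ (suc p) f with f zero
... | true  = ≡.cong suc (∣tabulate∣-↑ p (f ∘ suc))
... | false = ∣tabulate∣-↑ p (f ∘ suc)

∣tabulate∣-combine : ∀ p {q k} (f : Fin (p ℕ.* q) → Bool) →
                     (∀ i → ∣ tabulate (f ∘ combine {p} {q} i) ∣ ≡ k) → ∣ tabulate f ∣ ≡ p ℕ.* k
∣tabulate∣-combine zero        f rows = ≡.refl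
∣tabulate∣-combine (suc p) {q} f rows = ≡.trans (∣tabulate∣-↑ q f)
  (≡.cong₂ ℕ._+_ (rows zero) (∣tabulate∣-combine p (f ∘ (q ↑ʳ_)) (rows ∘ suc)))

∣tabulate∣-lookup : ∀ {n} {f : Fin n → Bool} (s : Subset n) → f ≗ lookup s → ∣ tabulate f ∣ ≡ ∣ s ∣
∣tabulate∣-lookup s f≗s = ≡.cong ∣_∣ (≡.trans (tabulate-cong f≗s) (tabulate∘lookup s))

lookup-⁅⁆ : ∀ {n} (j i : Fin n) → lookup ⁅ j ⁆ i ≡ does (i Fin.≟ j)
lookup-⁅⁆ zero    zero    = ≡.refl
lookup-⁅⁆ zero    (suc i) = lookup-replicate i false
lookup-⁅⁆ (suc j) zero    = ≡.refl
lookup-⁅⁆ (suc j) (suc i) = lookup-⁅⁆ j i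

∣tabulate-≢∣ : ∀ {n} (j : Fin n) → ∣ tabulate (λ i → not (does (i Fin.≟ j))) ∣ ≡ n ∸ 1
∣tabulate-≢∣ {n} j = begin
  ∣ tabulate (λ i → not (does (i Fin.≟ j))) ∣  ≡⟨ ∣tabulate∣-lookup (∁ ⁅ j ⁆) lookup-∁⁅j⁆ ⟩
  ∣ ∁ ⁅ j ⁆ ∣                                  ≡⟨ ∣∁p∣≡n∸∣p∣ ⁅ j ⁆ ⟩
  n ∸ ∣ ⁅ j ⁆ ∣                                ≡⟨ ≡.cong (n ∸_) (∣⁅x⁆∣≡1 j) ⟩
  n ∸ 1                                        ∎
  where
  open ≡.≡-Reasoning
  lookup-∁⁅j⁆ : ∀ i → not (does (i Fin.≟ j)) ≡ lookup (∁ ⁅ j ⁆) i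
  lookup-∁⁅j⁆ i = ≡.sym (≡.trans (lookup-map i not ⁅ j ⁆) (≡.cong not (lookup-⁅⁆ j i)))

module Linear {c ℓ : Level} (G : AbelianGroup c ℓ) where
  open AbelianGroup G renaming (Carrier to A)
  open import Algebra.Properties.AbelianGroup G using (⁻¹-∙-comm; ε⁻¹≈ε; ⁻¹-involutive; inverseʳ-unique)
  open import Algebra.Properties.CommutativeSemigroup commutativeSemigroup using (interchange)
  open import Relation.Binary.Reasoning.Setoid setoid

  _·_ : ℤ → A → A
  _·_ = intMul G

  private
    _·ℕ_ : ℕ → A → A
    _·ℕ_ = natMul G

  natMul-cong : ∀ p {x y} → x ≈ y → p ·ℕ x ≈ p ·ℕ y
  natMul-cong zero    x≈y = refl
  natMul-cong (suc p) x≈y = ∙-cong x≈y (natMul-cong p x≈y)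

  natMul-+ : ∀ p q x → (p ℕ.+ q) ·ℕ x ≈ p ·ℕ x ∙ q ·ℕ x
  natMul-+ zero    q x = sym (identityˡ _)
  natMul-+ (suc p) q x = trans (∙-congˡ (natMul-+ p q x)) (sym (assoc _ _ _))

  natMul-∙ : ∀ p x y → p ·ℕ (x ∙ y) ≈ p ·ℕ x ∙ p ·ℕ y
  natMul-∙ zero    x y = sym (identityˡ _)
  natMul-∙ (suc p) x y = trans (∙-congˡ (natMul-∙ p x y)) (interchange _ _ _ _)

  natMul-ε : ∀ p → p ·ℕ ε ≈ ε
  natMul-ε zero    = refl
  natMul-ε (suc p) = trans (identityˡ _) (natMul-ε p)

  ∙-cancel-∙⁻¹ : ∀ x a b → (x ∙ a) ∙ (x ∙ b) ⁻¹ ≈ a ∙ b ⁻¹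
  ∙-cancel-∙⁻¹ x a b = begin
    (x ∙ a) ∙ (x ∙ b) ⁻¹         ≈⟨ ∙-congˡ (⁻¹-∙-comm x b) ⟨
    (x ∙ a) ∙ (x ⁻¹ ∙ b ⁻¹)      ≈⟨ interchange x a (x ⁻¹) (b ⁻¹) ⟩
    (x ∙ x ⁻¹) ∙ (a ∙ b ⁻¹)      ≈⟨ ∙-congʳ (inverseʳ x) ⟩
    ε ∙ (a ∙ b ⁻¹)               ≈⟨ identityˡ _ ⟩
    a ∙ b ⁻¹                     ∎

  intMul-⊖ : ∀ p q x → (p ⊖ q) · x ≈ p ·ℕ x ∙ (q ·ℕ x) ⁻¹
  intMul-⊖ zero    zero    x = sym (trans (identityˡ _) ε⁻¹≈ε)
  intMul-⊖ (suc p) zero    x = sym (trans (∙-congˡ ε⁻¹≈ε) (identityʳ _))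
  intMul-⊖ zero    (suc q) x = sym (identityˡ _)
  intMul-⊖ (suc p) (suc q) x = begin
    (suc p ⊖ suc q) · x           ≡⟨ ≡.cong (_· x) (ℤ.[1+m]⊖[1+n]≡m⊖n p q) ⟩
    (p ⊖ q) · x                   ≈⟨ intMul-⊖ p q x ⟩
    p ·ℕ x ∙ (q ·ℕ x) ⁻¹          ≈⟨ ∙-cancel-∙⁻¹ x (p ·ℕ x) (q ·ℕ x) ⟨
    suc p ·ℕ x ∙ (suc q ·ℕ x) ⁻¹  ∎

  intMul-+ : ∀ u v x → (u ℤ.+ v) · x ≈ u · x ∙ v · x
  intMul-+ (+ p)    (+ q)    x = natMul-+ p q x
  intMul-+ (+ p)    -[1+ q ] x = intMul-⊖ p (suc q) x
  intMul-+ -[1+ p ] (+ q)    x = trans (intMul-⊖ q (suc p) x) (comm _ _)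
  intMul-+ -[1+ p ] -[1+ q ] x = begin
    (suc (suc (p ℕ.+ q)) ·ℕ x) ⁻¹      ≡⟨ ≡.cong (λ k → (k ·ℕ x) ⁻¹) (ℕ.+-suc (suc p) q) ⟨
    ((suc p ℕ.+ suc q) ·ℕ x) ⁻¹        ≈⟨ ⁻¹-cong (natMul-+ (suc p) (suc q) x) ⟩
    (suc p ·ℕ x ∙ suc q ·ℕ x) ⁻¹       ≈⟨ ⁻¹-∙-comm _ _ ⟨
    (suc p ·ℕ x) ⁻¹ ∙ (suc q ·ℕ x) ⁻¹  ∎

  intMul-neg : ∀ u x → (ℤ.- u) · x ≈ (u · x) ⁻¹
  intMul-neg (+ zero)  x = sym ε⁻¹≈ε
  intMul-neg (+ suc p) x = refl
  intMul-neg -[1+ p ]  x = sym (⁻¹-involutive _)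

  intMul-*⁺ : ∀ p v x → (+ p ℤ.* v) · x ≈ p ·ℕ (v · x)
  intMul-*⁺ zero    v x = refl
  intMul-*⁺ (suc p) v x = begin
    (+ suc p ℤ.* v) · x      ≡⟨ ≡.cong (_· x) (ℤ.suc-* (+ p) v) ⟩
    (v ℤ.+ + p ℤ.* v) · x    ≈⟨ intMul-+ v (+ p ℤ.* v) x ⟩
    v · x ∙ (+ p ℤ.* v) · x  ≈⟨ ∙-congˡ (intMul-*⁺ p v x) ⟩
    v · x ∙ p ·ℕ (v · x)     ∎

  intMul-* : ∀ u v x → (u ℤ.* v) · x ≈ u · (v · x)
  intMul-* (+ p)    v x = intMul-*⁺ p v x
  intMul-* -[1+ p ] v x = begin
    (-[1+ p ] ℤ.* v) · x        ≡⟨ ≡.cong (_· x) (ℤ.neg-distribˡ-* (+ suc p) v) ⟨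
    (ℤ.- (+ suc p ℤ.* v)) · x   ≈⟨ intMul-neg (+ suc p ℤ.* v) x ⟩
    ((+ suc p ℤ.* v) · x) ⁻¹    ≈⟨ ⁻¹-cong (intMul-*⁺ (suc p) v x) ⟩
    (suc p ·ℕ (v · x)) ⁻¹       ∎

  intMul-cong : ∀ u {x y} → x ≈ y → u · x ≈ u · y
  intMul-cong (+ p)    x≈y = natMul-cong p x≈y
  intMul-cong -[1+ p ] x≈y = ⁻¹-cong (natMul-cong (suc p) x≈y)

  intMul-∙ : ∀ u x y → u · (x ∙ y) ≈ u · x ∙ u · y
  intMul-∙ (+ p)    x y = natMul-∙ p x y
  intMul-∙ -[1+ p ] x y = trans (⁻¹-cong (natMul-∙ (suc p) x y)) (sym (⁻¹-∙-comm _ _))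

  intMul-ε : ∀ u → u · ε ≈ ε
  intMul-ε (+ p)    = natMul-ε p
  intMul-ε -[1+ p ] = trans (⁻¹-cong (natMul-ε (suc p))) ε⁻¹≈ε

  intMul-⁻¹ : ∀ u x → u · (x ⁻¹) ≈ (u · x) ⁻¹
  intMul-⁻¹ u x = inverseʳ-unique (u · x) (u · (x ⁻¹)) (begin
    u · x ∙ u · (x ⁻¹)  ≈⟨ intMul-∙ u x (x ⁻¹) ⟨
    u · (x ∙ x ⁻¹)      ≈⟨ intMul-cong u (inverseʳ x) ⟩
    u · ε               ≈⟨ intMul-ε u ⟩
    ε                   ∎)

  ∑ : ∀ {n} → (Fin n → A) → A
  ∑ = sumG G

  sumG-cong : ∀ {n} {f g : Fin n → A} → (∀ i → f i ≈ g i) → ∑ f ≈ ∑ g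
  sumG-cong {zero}  f≈g = refl
  sumG-cong {suc n} f≈g = ∙-cong (f≈g zero) (sumG-cong (f≈g ∘ suc))

  sumG-ε : ∀ {n} {f : Fin n → A} → (∀ i → f i ≈ ε) → ∑ f ≈ ε
  sumG-ε {zero}  f≈ε = refl
  sumG-ε {suc n} f≈ε = trans (∙-cong (f≈ε zero) (sumG-ε (f≈ε ∘ suc))) (identityˡ ε)

  sumG-∙ : ∀ {n} (f g : Fin n → A) → ∑ (λ i → f i ∙ g i) ≈ ∑ f ∙ ∑ g
  sumG-∙ {zero}  f g = sym (identityˡ ε)
  sumG-∙ {suc n} f g = trans (∙-congˡ (sumG-∙ (f ∘ suc) (g ∘ suc))) (interchange _ _ _ _)

  sumG-⁻¹ : ∀ {n} (f : Fin n → A) → ∑ (λ i → f i ⁻¹) ≈ (∑ f) ⁻¹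
  sumG-⁻¹ {zero}  f = sym ε⁻¹≈ε
  sumG-⁻¹ {suc n} f = trans (∙-congˡ (sumG-⁻¹ (f ∘ suc))) (⁻¹-∙-comm _ _)

  sumG-∙⁻¹ : ∀ {n} (f g : Fin n → A) → ∑ (λ i → f i ∙ g i ⁻¹) ≈ ∑ f ∙ (∑ g) ⁻¹
  sumG-∙⁻¹ f g = trans (sumG-∙ f (λ i → g i ⁻¹)) (∙-congˡ (sumG-⁻¹ g))

  sumG-intMulʳ : ∀ {n} u (f : Fin n → A) → ∑ (λ i → u · f i) ≈ u · ∑ f
  sumG-intMulʳ {zero}  u f = sym (intMul-ε u)
  sumG-intMulʳ {suc n} u f = trans (∙-congˡ (sumG-intMulʳ u (f ∘ suc))) (sym (intMul-∙ u _ _))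

  sumG-intMulˡ : ∀ {n} (f : Fin n → ℤ) x → ∑ (λ i → f i · x) ≈ sum f · x
  sumG-intMulˡ {zero}  f x = refl
  sumG-intMulˡ {suc n} f x = trans (∙-congˡ (sumG-intMulˡ (f ∘ suc) x)) (sym (intMul-+ (f zero) _ x))

  sumG-swap : ∀ {m n} (f : Fin m → Fin n → A) → ∑ (λ i → ∑ (f i)) ≈ ∑ (λ j → ∑ (λ i → f i j))
  sumG-swap {zero} {n} f = sym (sumG-ε {n} (λ _ → refl))
  sumG-swap {suc m} f = trans (∙-congˡ (sumG-swap (f ∘ suc))) (sym (sumG-∙ (f zero) _))

  sumG-↑ : ∀ p {q} (f : Fin (p ℕ.+ q) → A) → ∑ f ≈ ∑ (f ∘ (_↑ˡ q)) ∙ ∑ (f ∘ (p ↑ʳ_))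
  sumG-↑ zero    f = sym (identityˡ _)
  sumG-↑ (suc p) f = trans (∙-congˡ (sumG-↑ p (f ∘ suc))) (sym (assoc _ _ _))

  sumG-combine : ∀ p {q} (f : Fin (p ℕ.* q) → A) → ∑ f ≈ ∑ (λ i → ∑ (f ∘ combine {p} {q} i))
  sumG-combine zero        f = refl
  sumG-combine (suc p) {q} f = trans (sumG-↑ q f) (∙-congˡ (sumG-combine p (f ∘ (q ↑ʳ_))))

  sumG-single : ∀ {n} (f : Fin n → A) i → (∀ j → j ≢ i → f j ≈ ε) → ∑ f ≈ f i
  sumG-single {suc n} f zero    f≈ε =
    trans (∙-congˡ (sumG-ε (λ j → f≈ε (suc j) λ ()))) (identityʳ _)
  sumG-single {suc n} f (suc i) f≈ε = trans (∙-congʳ (f≈ε zero λ ())) (trans (identityˡ _)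
    (sumG-single (f ∘ suc) i (λ j j≢i → f≈ε (suc j) (j≢i ∘ Fin.suc-injective))))

  sumG-δ : ∀ {k} (i : Fin k) (v : Fin k → A) → ∑ (λ j → δ i j · v j) ≈ v i
  sumG-δ i v = begin
    ∑ (λ j → δ i j · v j)  ≈⟨ sumG-single _ i (λ j j≢i → reflexive (≡.cong (_· v j) (δ-off (j≢i ∘ ≡.sym)))) ⟩
    δ i i · v i            ≡⟨ ≡.cong (_· v i) (δ-diag i) ⟩
    (+ 1) · v i            ≈⟨ identityʳ (v i) ⟩
    v i                    ∎

  apply-cong : ∀ {m n} (M : ZMatrix m n) {x y} → _≋_ G x y → _≋_ G (apply G M x) (apply G M y)
  apply-cong M x≋y j = sumG-cong (λ i → intMul-cong (M j i) (x≋y i))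

  apply-ε : ∀ {m n} (M : ZMatrix m n) {x} → IsZero G x → IsZero G (apply G M x)
  apply-ε M x≈ε j = sumG-ε (λ i → trans (intMul-cong (M j i) (x≈ε i)) (intMul-ε (M j i)))

  apply-∙ : ∀ {m n} (M : ZMatrix m n) x y j →
            apply G M (λ i → x i ∙ y i) j ≈ apply G M x j ∙ apply G M y j
  apply-∙ M x y j = trans (sumG-cong (λ i → intMul-∙ (M j i) (x i) (y i)))
                          (sumG-∙ (λ i → M j i · x i) (λ i → M j i · y i))

  intMul-comm : ∀ u v x → u · (v · x) ≈ v · (u · x)
  intMul-comm u v x = begin
    u · (v · x)    ≈⟨ intMul-* u v x ⟨
    (u ℤ.* v) · x  ≡⟨ ≡.cong (_· x) (ℤ.*-comm u v) ⟩
    (v ℤ.* u) · x  ≈⟨ intMul-* v u x ⟩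
    v · (u · x)    ∎

  sumG²-∙⁻¹ : ∀ {n} (f g : Fin n → Fin n → A) →
              ∑ (λ a → ∑ (λ b → f a b ∙ g a b ⁻¹)) ≈ ∑ (λ a → ∑ (f a)) ∙ (∑ (λ a → ∑ (g a))) ⁻¹
  sumG²-∙⁻¹ f g = trans (sumG-cong (λ a → sumG-∙⁻¹ (f a) (g a)))
                        (sumG-∙⁻¹ (λ a → ∑ (f a)) (λ a → ∑ (g a)))

  -- The two halves of the minor are exchanged by transposing (a, b).
  sumG-minor : ∀ {n} (u w : Fin n → ℤ) (Y : Fin n → Fin n → A) →
    ∑ (λ a → ∑ (λ b → (u b ℤ.* w a ℤ.- u a ℤ.* w b) · Y a b))
      ≈ ∑ (λ b → u b · ∑ (λ a → w a · (Y a b ∙ Y b a ⁻¹)))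
  sumG-minor u w Y = begin
    ∑ (λ a → ∑ (λ b → (u b ℤ.* w a ℤ.- u a ℤ.* w b) · Y a b))
      ≈⟨ sumG-cong (λ a → sumG-cong (λ b → split-difference a b)) ⟩
    ∑ (λ a → ∑ (λ b → f a b ∙ g b a ⁻¹))
      ≈⟨ sumG²-∙⁻¹ f (λ a b → g b a) ⟩
    ∑ (λ a → ∑ (f a)) ∙ (∑ (λ a → ∑ (λ b → g b a))) ⁻¹
      ≈⟨ ∙-congˡ (⁻¹-cong (sumG-swap (λ a b → g b a))) ⟩
    ∑ (λ a → ∑ (f a)) ∙ (∑ (λ a → ∑ (g a))) ⁻¹
      ≈⟨ sumG²-∙⁻¹ f g ⟨
    ∑ (λ a → ∑ (λ b → f a b ∙ g a b ⁻¹))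
      ≈⟨ sumG-cong (λ a → sumG-cong (λ b → merge-difference a b)) ⟩
    ∑ (λ a → ∑ (λ b → u b · (w a · (Y a b ∙ Y b a ⁻¹))))
      ≈⟨ sumG-swap (λ a b → u b · (w a · (Y a b ∙ Y b a ⁻¹))) ⟩
    ∑ (λ b → ∑ (λ a → u b · (w a · (Y a b ∙ Y b a ⁻¹))))
      ≈⟨ sumG-cong (λ b → sumG-intMulʳ (u b) (λ a → w a · (Y a b ∙ Y b a ⁻¹))) ⟩
    ∑ (λ b → u b · ∑ (λ a → w a · (Y a b ∙ Y b a ⁻¹))) ∎
    where
    f g : Fin _ → Fin _ → A
    f a b = (u b ℤ.* w a) · Y a b
    g a b = (u b ℤ.* w a) · Y b a
    split-difference : ∀ a b → (u b ℤ.* w a ℤ.- u a ℤ.* w b) · Y a b ≈ f a b ∙ g b a ⁻¹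
    split-difference a b = trans (intMul-+ (u b ℤ.* w a) _ (Y a b)) (∙-congˡ (intMul-neg (u a ℤ.* w b) (Y a b)))
    merge-difference : ∀ a b → f a b ∙ g a b ⁻¹ ≈ u b · (w a · (Y a b ∙ Y b a ⁻¹))
    merge-difference a b = begin
      f a b ∙ g a b ⁻¹                            ≈⟨ ∙-congˡ (intMul-⁻¹ (u b ℤ.* w a) (Y b a)) ⟨
      f a b ∙ (u b ℤ.* w a) · (Y b a ⁻¹)          ≈⟨ intMul-∙ (u b ℤ.* w a) _ _ ⟨
      (u b ℤ.* w a) · (Y a b ∙ Y b a ⁻¹)          ≈⟨ intMul-* (u b) (w a) _ ⟩
      u b · (w a · (Y a b ∙ Y b a ⁻¹))            ∎

  RowSections : ∀ {m n} → ZMatrix m n → ZMatrix m n → Set (c ⊔ ℓ)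
  RowSections N R = ∀ j g → apply G N (λ a → R j a · g) j ≈ g

record KernelIsImage {c ℓ} (G : AbelianGroup c ℓ) {r m n} (M : ZMatrix r m) (N : ZMatrix m n) : Set (c ⊔ ℓ) where
  field
    image⊆ker : ∀ v → IsZero G (apply G M (apply G N v))
    ker⊆image : ∀ y → IsZero G (apply G M y) → ∃ λ v → _≋_ G (apply G N v) y

module Construction {m n : ℕ} (N : ZMatrix m n) where

  data Coord : Set where
    free  : Fin n → Coord
    block : Fin n → Fin n → Fin m → Coord

  T : ℕ
  T = n ℕ.+ (n ℕ.* n) ℕ.* m

  enc : Coord → Fin T
  enc (free l)      = l ↑ˡ (n ℕ.* n) ℕ.* m
  enc (block a b j) = n ↑ʳ combine (combine a b) j

  decBlock : Fin (n ℕ.* n) × Fin m → Coord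
  decBlock (ab , j) = let a , b = remQuot {n} n ab in block a b j

  dec : Fin T → Coord
  dec i = [ free , decBlock ∘ remQuot m ]′ (splitAt n i)

  dec-↑ʳ : ∀ (ab : Fin (n ℕ.* n)) j → dec (n ↑ʳ combine ab j) ≡ decBlock (ab , j)
  dec-↑ʳ ab j rewrite Fin.splitAt-↑ʳ n ((n ℕ.* n) ℕ.* m) (combine ab j) =
    ≡.cong decBlock (Fin.remQuot-combine ab j)

  dec-enc : ∀ x → dec (enc x) ≡ x
  dec-enc (free l) rewrite Fin.splitAt-↑ˡ n l ((n ℕ.* n) ℕ.* m) = ≡.refl
  dec-enc (block a b j) = ≡.trans (dec-↑ʳ (combine a b) j)
    (≡.cong (λ (a , b) → block a b j) (Fin.remQuot-combine {n} {n} a b))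

  minor : (Fin n → ℤ) → Fin n → Fin n → Fin m → ℤ
  minor u a b j = u b ℤ.* N j a ℤ.- u a ℤ.* N j b

  coeff : (Fin n → ℤ) → Coord → ℤ
  coeff u (free l)      = u l
  coeff u (block a b j) = minor u a b j

  Ψ : ZMatrix m T
  Ψ j i = coeff (N j) (dec i)

  inC : Fin m → Coord → Bool
  inC j (free _)       = true
  inC j (block _ _ j′) = not (does (j′ Fin.≟ j))

  C : Fin m → Subset T
  C j = tabulate (inC j ∘ dec)

  inC≡lookup-C : ∀ j i → inC j (dec i) ≡ lookup (C j) i
  inC≡lookup-C j i = ≡.sym (lookup∘tabulate (inC j ∘ dec) i)

  lookup-C-enc : ∀ j x → lookup (C j) (enc x) ≡ inC j x
  lookup-C-enc j x = ≡.trans (≡.sym (inC≡lookup-C j (enc x))) (≡.cong (inC j) (dec-enc x))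

  K : ℕ
  K = n ℕ.+ (n ℕ.* n) ℕ.* (m ∸ 1)

  ∣C∣≡K : ∀ j → ∣ C j ∣ ≡ K
  ∣C∣≡K j = begin
    ∣ C j ∣
      ≡⟨ ∣tabulate∣-↑ n (inC j ∘ dec) ⟩
    ∣ tabulate (λ l → inC j (dec (l ↑ˡ (n ℕ.* n) ℕ.* m))) ∣ ℕ.+ ∣ tabulate (λ k → inC j (dec (n ↑ʳ k))) ∣
      ≡⟨ ≡.cong₂ ℕ._+_ (≡.trans (∣tabulate∣-lookup ⊤ free∈C) (∣⊤∣≡n n))
                       (∣tabulate∣-combine (n ℕ.* n) _ block-row) ⟩
    K ∎
    where
    open ≡.≡-Reasoning
    free∈C : ∀ l → inC j (dec (l ↑ˡ (n ℕ.* n) ℕ.* m)) ≡ lookup ⊤ l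
    free∈C l = ≡.trans (≡.cong (inC j) (dec-enc (free l))) (≡.sym (lookup-replicate l true))
    block-row : ∀ ab → ∣ tabulate (λ j′ → inC j (dec (n ↑ʳ combine ab j′))) ∣ ≡ m ∸ 1
    block-row ab = ≡.trans (≡.cong ∣_∣ (tabulate-cong (λ j′ → ≡.cong (inC j) (dec-↑ʳ ab j′))))
                           (∣tabulate-≢∣ j)

  C-injective : Fin n → ∀ j j′ → C j ≡ C j′ → j ≡ j′
  C-injective a j j′ Cj≡Cj′ = not-does-≟⇒≡ (begin
    not (does (j Fin.≟ j′))        ≡⟨ lookup-C-enc j′ (block a a j) ⟨
    lookup (C j′) e                ≡⟨ ≡.cong (λ s → lookup s e) Cj≡Cj′ ⟨
    lookup (C j) e                 ≡⟨ lookup-C-enc j (block a a j) ⟩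
    not (does (j Fin.≟ j))         ≡⟨ ≡.cong not (dec-true (j Fin.≟ j) ≡.refl) ⟩
    false                          ∎)
    where
    open ≡.≡-Reasoning
    e = enc (block a a j)

  coeff-outside : ∀ j x → inC j x ≡ false → coeff (N j) x ≡ + 0
  coeff-outside j (block a b j′) e =
    ≡.subst (λ k → minor (N j) a b k ≡ + 0) (≡.sym (not-does-≟⇒≡ e)) (minor-self (N j a) (N j b))
    where
    minor-self : ∀ x y → y ℤ.* x ℤ.- x ℤ.* y ≡ + 0
    minor-self = solve-∀

  module _ {c ℓ : Level} (G : AbelianGroup c ℓ) where
    open AbelianGroup G renaming (Carrier to A)
    open Linear G
    open import Relation.Binary.Reasoning.Setoid setoid

    q : Fin m → (Fin n → Fin n → A) → Fin n → A
    q j Y b = ∑ (λ a → N j a · (Y a b ∙ Y b a ⁻¹))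

    P : (Fin T → A) → Fin n → A
    P x l = x (enc (free l)) ∙ ∑ (λ j → q j (λ a b → x (enc (block a b j))) l)

    q-cong : ∀ j {Y Y′} → (∀ a b → Y a b ≈ Y′ a b) → ∀ b → q j Y b ≈ q j Y′ b
    q-cong j Y≈Y′ b = sumG-cong (λ a → intMul-cong (N j a) (∙-cong (Y≈Y′ a b) (⁻¹-cong (Y≈Y′ b a))))

    q-ε : ∀ j {Y} → (∀ a b → Y a b ≈ ε) → ∀ b → q j Y b ≈ ε
    q-ε j {Y} Y≈ε b = sumG-ε (λ a → trans (intMul-cong (N j a) (antisymmetric-ε a)) (intMul-ε (N j a)))
      where
      antisymmetric-ε : ∀ a → Y a b ∙ Y b a ⁻¹ ≈ ε
      antisymmetric-ε a = trans (∙-cong (Y≈ε a b) (⁻¹-cong (Y≈ε b a))) (inverseʳ ε)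

    sumG-coords : ∀ (f : Fin T → A) →
      ∑ f ≈ ∑ (λ l → f (enc (free l))) ∙ ∑ (λ a → ∑ (λ b → ∑ (λ j → f (enc (block a b j)))))
    sumG-coords f = trans (sumG-↑ n f) (∙-congˡ (trans (sumG-combine (n ℕ.* n) (f ∘ (n ↑ʳ_)))
      (sumG-combine n (λ ab → ∑ (λ j → f (n ↑ʳ combine ab j))))))

    Ψ≋N∘P : ∀ x j → apply G Ψ x j ≈ apply G N (P x) j
    Ψ≋N∘P x j = begin
      ∑ (λ i → Ψ j i · x i)
        ≈⟨ sumG-coords (λ i → Ψ j i · x i) ⟩
      ∑ (λ l → Ψ j (enc (free l)) · X (free l)) ∙ ∑ (λ a → ∑ (λ b → ∑ (λ j′ → Ψ j (enc (block a b j′)) · X (block a b j′))))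
        ≈⟨ ∙-cong (sumG-cong (λ l → coeff-enc (free l)))
                  (sumG-cong (λ a → sumG-cong (λ b → sumG-cong (λ j′ → coeff-enc (block a b j′))))) ⟩
      ∑ (λ l → N j l · X (free l)) ∙ ∑ (λ a → ∑ (λ b → ∑ (λ j′ → minor (N j) a b j′ · Y j′ a b)))
        ≈⟨ ∙-congˡ (trans (sumG-cong (λ a → sumG-swap (λ b j′ → minor (N j) a b j′ · Y j′ a b)))
                          (sumG-swap (λ a j′ → ∑ (λ b → minor (N j) a b j′ · Y j′ a b)))) ⟩
      ∑ (λ l → N j l · X (free l)) ∙ ∑ (λ j′ → ∑ (λ a → ∑ (λ b → minor (N j) a b j′ · Y j′ a b)))
        ≈⟨ ∙-congˡ (sumG-cong (λ j′ → sumG-minor (N j) (N j′) (Y j′))) ⟩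
      ∑ (λ l → N j l · X (free l)) ∙ ∑ (λ j′ → ∑ (λ l → N j l · q j′ (Y j′) l))
        ≈⟨ ∙-congˡ (sumG-swap (λ j′ l → N j l · q j′ (Y j′) l)) ⟩
      ∑ (λ l → N j l · X (free l)) ∙ ∑ (λ l → ∑ (λ j′ → N j l · q j′ (Y j′) l))
        ≈⟨ sumG-∙ (λ l → N j l · X (free l)) (λ l → ∑ (λ j′ → N j l · q j′ (Y j′) l)) ⟨
      ∑ (λ l → N j l · X (free l) ∙ ∑ (λ j′ → N j l · q j′ (Y j′) l))
        ≈⟨ sumG-cong (λ l → trans (∙-congˡ (sumG-intMulʳ (N j l) (λ j′ → q j′ (Y j′) l))) (sym (intMul-∙ (N j l) _ _))) ⟩
      ∑ (λ l → N j l · P x l) ∎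
      where
      X : Coord → A
      X = x ∘ enc
      Y : Fin m → Fin n → Fin n → A
      Y j′ a b = X (block a b j′)
      coeff-enc : ∀ y → Ψ j (enc y) · X y ≈ coeff (N j) y · X y
      coeff-enc y = reflexive (≡.cong (λ y′ → coeff (N j) y′ · X y) (dec-enc y))

    onFree : (Fin n → A) → Coord → A
    onFree v (free l)      = v l
    onFree v (block _ _ _) = ε

    onBlock : Fin m → (Fin n → Fin n → A) → Coord → A
    onBlock j Y (free _)       = ε
    onBlock j Y (block a b j′) = if does (j′ Fin.≟ j) then Y a b else ε

    onBlock-≢ : ∀ {j j′} Y a b → j′ ≢ j → onBlock j Y (block a b j′) ≈ ε
    onBlock-≢ {j} {j′} Y a b j′≢j = reflexive (≡.cong (if_then Y a b else ε) (dec-false (j′ Fin.≟ j) j′≢j))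

    onBlock-≡ : ∀ j Y a b → onBlock j Y (block a b j) ≈ Y a b
    onBlock-≡ j Y a b = reflexive (≡.cong (if_then Y a b else ε) (dec-true (j Fin.≟ j) ≡.refl))

    P-∘dec : ∀ (h : Coord → A) l → P (h ∘ dec) l ≈ h (free l) ∙ ∑ (λ j → q j (λ a b → h (block a b j)) l)
    P-∘dec h l = ∙-cong (reflexive (≡.cong h (dec-enc (free l))))
                        (sumG-cong (λ j → q-cong j (λ a b → reflexive (≡.cong h (dec-enc (block a b j)))) l))

    P-onFree : ∀ v l → P (onFree v ∘ dec) l ≈ v l
    P-onFree v l = begin
      P (onFree v ∘ dec) l               ≈⟨ P-∘dec (onFree v) l ⟩
      v l ∙ ∑ (λ j → q j (λ _ _ → ε) l)  ≈⟨ ∙-congˡ (sumG-ε (λ j → q-ε j (λ _ _ → refl) l)) ⟩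
      v l ∙ ε                            ≈⟨ identityʳ (v l) ⟩
      v l                                ∎

    P-onBlock : ∀ j Y l → P (onBlock j Y ∘ dec) l ≈ q j Y l
    P-onBlock j Y l = begin
      P (onBlock j Y ∘ dec) l
        ≈⟨ P-∘dec (onBlock j Y) l ⟩
      ε ∙ ∑ (λ j′ → q j′ (λ a b → onBlock j Y (block a b j′)) l)
        ≈⟨ identityˡ _ ⟩
      ∑ (λ j′ → q j′ (λ a b → onBlock j Y (block a b j′)) l)
        ≈⟨ sumG-single _ j (λ j′ j′≢j → q-ε j′ (λ a b → onBlock-≢ Y a b j′≢j) l) ⟩
      q j (λ a b → onBlock j Y (block a b j)) l
        ≈⟨ q-cong j (onBlock-≡ j Y) l ⟩
      q j Y l ∎

    onBlock-outside : ∀ j Y x → inC j x ≡ true → onBlock j Y x ≈ ε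
    onBlock-outside j Y (free _)       _ = refl
    onBlock-outside j Y (block a b j′) e with j′ Fin.≟ j
    ... | no _ = refl

    ψ-local : ∀ j x y → (∀ i → lookup (C j) i ≡ true → x i ≈ y i) → apply G Ψ x j ≈ apply G Ψ y j
    ψ-local j x y x≈y = sumG-cong term
      where
      term : ∀ i → Ψ j i · x i ≈ Ψ j i · y i
      term i with lookup (C j) i in e
      ... | true  = intMul-cong (Ψ j i) (x≈y i e)
      ... | false = reflexive (≡.trans (≡.cong (_· x i) Ψji≡0) (≡.sym (≡.cong (_· y i) Ψji≡0)))
        where
        Ψji≡0 : Ψ j i ≡ + 0
        Ψji≡0 = coeff-outside j (dec i) (≡.trans (inC≡lookup-C j i) e)

    q-section : ∀ R → RowSections N R → ∀ j v b →
                q j (λ a b → R j b · v a) b ≈ R j b · apply G N v j ∙ v b ⁻¹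
    q-section R sections j v b = begin
      ∑ (λ a → N j a · (R j b · v a ∙ (R j a · v b) ⁻¹))
        ≈⟨ sumG-cong (λ a → trans (intMul-∙ (N j a) _ _) (∙-congˡ (intMul-⁻¹ (N j a) _))) ⟩
      ∑ (λ a → N j a · (R j b · v a) ∙ (N j a · (R j a · v b)) ⁻¹)
        ≈⟨ sumG-∙⁻¹ (λ a → N j a · (R j b · v a)) (λ a → N j a · (R j a · v b)) ⟩
      ∑ (λ a → N j a · (R j b · v a)) ∙ (∑ (λ a → N j a · (R j a · v b))) ⁻¹
        ≈⟨ ∙-cong (trans (sumG-cong (λ a → intMul-comm (N j a) (R j b) (v a)))
                         (sumG-intMulʳ (R j b) (λ a → N j a · v a)))
                  (⁻¹-cong (sections j (v b))) ⟩
      R j b · apply G N v j ∙ v b ⁻¹ ∎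

    γ-inside : ∀ {j} z i → lookup (C j) i ≡ true → γ G (C j) z i ≈ z i
    γ-inside z i e = reflexive (≡.cong (if_then z i else ε) e)

    supp⊆C : ∀ j i → InSupp G Ψ j i → i ∈ C j
    supp⊆C j i ψ≉0 with lookup (C j) i in e
    ... | true  = lookup⇒[]= i (C j) e
    ... | false = ⊥-elim (ψ≉0 (λ g → trans (ψ-local j (γ₁ G i g) (λ _ → ε) (γ₁-outside g))
                                            (apply-ε Ψ (λ _ → refl) j)))
      where
      γ₁-outside : ∀ g i′ → lookup (C j) i′ ≡ true → γ₁ G i g i′ ≈ ε
      γ₁-outside g i′ e′ with i′ Fin.≟ i
      ... | yes ≡.refl = case ≡.trans (≡.sym e′) e of λ ()
      ... | no _       = refl

    proj⊆ker : ∀ j x → IsZero G (apply G Ψ x) → apply G Ψ (γ G (C j) x) j ≈ ε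
    proj⊆ker j x Ψx≈ε = trans (ψ-local j (γ G (C j) x) x (γ-inside x)) (Ψx≈ε j)

    ker⊆proj : ∀ R → RowSections N R → ∀ j z → apply G Ψ (γ G (C j) z) j ≈ ε →
               ∃ λ x → IsZero G (apply G Ψ x) × (∀ i → i ∈ C j → x i ≈ z i)
    ker⊆proj R sections j z ψw≈ε = x , Ψx≈ε , agree
      where
      w : Fin T → A
      w = γ G (C j) z
      v : Fin n → A
      v = P w
      correction : Fin T → A
      correction = onBlock j (λ a b → R j b · v a) ∘ dec
      x : Fin T → A
      x i = w i ∙ correction i

      agree : ∀ i → i ∈ C j → x i ≈ z i
      agree i i∈C = trans (∙-cong (γ-inside z i inside)
                                  (onBlock-outside j _ (dec i) (≡.trans (inC≡lookup-C j i) inside)))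
                          (identityʳ (z i))
        where inside = []=⇒lookup i∈C

      Nv≈ε : apply G N v j ≈ ε
      Nv≈ε = trans (sym (Ψ≋N∘P w j)) ψw≈ε

      cancels : ∀ l → v l ∙ P correction l ≈ ε
      cancels l = begin
        v l ∙ P correction l                   ≈⟨ ∙-congˡ (trans (P-onBlock j _ l) (q-section R sections j v l)) ⟩
        v l ∙ (R j l · apply G N v j ∙ v l ⁻¹) ≈⟨ ∙-congˡ (∙-congʳ (trans (intMul-cong (R j l) Nv≈ε) (intMul-ε (R j l)))) ⟩
        v l ∙ (ε ∙ v l ⁻¹)                     ≈⟨ ∙-congˡ (identityˡ _) ⟩
        v l ∙ v l ⁻¹                           ≈⟨ inverseʳ (v l) ⟩
        ε                                      ∎

      Ψx≈ε : IsZero G (apply G Ψ x)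
      Ψx≈ε j′ = begin
        apply G Ψ x j′                                ≈⟨ apply-∙ Ψ w correction j′ ⟩
        apply G Ψ w j′ ∙ apply G Ψ correction j′      ≈⟨ ∙-cong (Ψ≋N∘P w j′) (Ψ≋N∘P correction j′) ⟩
        apply G N v j′ ∙ apply G N (P correction) j′  ≈⟨ apply-∙ N v (P correction) j′ ⟨
        apply G N (λ l → v l ∙ P correction l) j′     ≈⟨ apply-ε N cancels j′ ⟩
        ε                                             ∎

    representation : ∀ {r} (M : ZMatrix r m) → KernelIsImage G M N →
                     ∀ R → RowSections N R → Fin n → IsRepresentation G M T K Ψ
    representation M ker R sections a = record
      { C         = C
      ; C-size    = ∣C∣≡K
      ; C-inj     = C-injective a
      ; supp⊆C    = supp⊆C
      ; image⊆ker = λ x i → trans (apply-cong M (Ψ≋N∘P x) i) (image⊆ker (P x) i)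
      ; ker⊆image = λ y y∈ker → let v , Nv≋y = ker⊆image y y∈ker in
          onFree v ∘ dec , λ j → trans (Ψ≋N∘P _ j) (trans (apply-cong N (P-onFree v) j) (Nv≋y j))
      ; proj⊆ker  = proj⊆ker
      ; ker⊆proj  = ker⊆proj R sections
      }
      where open KernelIsImage ker

↑-elim : ∀ {p} r {n} (P : Fin (r + n) → Set p) →
         (∀ i → P (i ↑ˡ n)) → (∀ l → P (r ↑ʳ l)) → ∀ j → P j
↑-elim r P left right j with splitAt r j in eq
... | inj₁ i = ≡.subst P (Fin.splitAt⁻¹-↑ˡ eq) (left i)
... | inj₂ l = ≡.subst P (Fin.splitAt⁻¹-↑ʳ eq) (right l)

augment-↑ˡ : ∀ r n (B : ZMatrix r n) i l → augment r n B i (l ↑ˡ n) ≡ δ i l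
augment-↑ˡ r n B i l rewrite Fin.splitAt-↑ˡ r l n = ≡.refl

augment-↑ʳ : ∀ r n (B : ZMatrix r n) i l → augment r n B i (r ↑ʳ l) ≡ B i l
augment-↑ʳ r n B i l rewrite Fin.splitAt-↑ʳ r n l = ≡.refl

negOverId : ∀ r n → ZMatrix r n → ZMatrix (r + n) n
negOverId r n X j = [ (λ i l → ℤ.- X i l) , δ ]′ (splitAt r j)

negOverId-↑ˡ : ∀ r n (X : ZMatrix r n) i → negOverId r n X (i ↑ˡ n) ≡ (λ l → ℤ.- X i l)
negOverId-↑ˡ r n X i = ≡.cong [ (λ i l → ℤ.- X i l) , δ ]′ (Fin.splitAt-↑ˡ r i n)

negOverId-↑ʳ : ∀ r n (X : ZMatrix r n) l → negOverId r n X (r ↑ʳ l) ≡ δ l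
negOverId-↑ʳ r n X l = ≡.cong [ (λ i l → ℤ.- X i l) , δ ]′ (Fin.splitAt-↑ʳ r n l)

module Augmented {c ℓ : Level} (G : AbelianGroup c ℓ) {r n : ℕ} (B : ZMatrix r n) where
  open AbelianGroup G renaming (Carrier to A)
  open Linear G
  open import Algebra.Properties.AbelianGroup G using (inverseˡ-unique)
  open import Relation.Binary.Reasoning.Setoid setoid

  apply-augment : ∀ y i → apply G (augment r n B) y i ≈ y (i ↑ˡ n) ∙ apply G B (λ l → y (r ↑ʳ l)) i
  apply-augment y i = trans (sumG-↑ r (λ j → augment r n B i j · y j))
    (∙-cong (trans (sumG-cong (λ l → reflexive (≡.cong (_· y (l ↑ˡ n)) (augment-↑ˡ r n B i l))))
                   (sumG-δ i (λ l → y (l ↑ˡ n))))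
            (sumG-cong (λ l → reflexive (≡.cong (_· y (r ↑ʳ l)) (augment-↑ʳ r n B i l)))))

  apply-negOverId-↑ˡ : ∀ (X : ZMatrix r n) v i → apply G (negOverId r n X) v (i ↑ˡ n) ≈ (apply G X v i) ⁻¹
  apply-negOverId-↑ˡ X v i = trans
    (sumG-cong (λ l → trans (reflexive (≡.cong (λ u → u l · v l) (negOverId-↑ˡ r n X i))) (intMul-neg (X i l) (v l))))
    (sumG-⁻¹ (λ l → X i l · v l))

  apply-negOverId-↑ʳ : ∀ (X : ZMatrix r n) v l → apply G (negOverId r n X) v (r ↑ʳ l) ≈ v l
  apply-negOverId-↑ʳ X v l =
    trans (sumG-cong (λ a → reflexive (≡.cong (λ u → u a · v a) (negOverId-↑ʳ r n X l)))) (sumG-δ l v)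

  kernelIsImage : KernelIsImage G (augment r n B) (negOverId r n B)
  kernelIsImage = record { image⊆ker = image⊆ker ; ker⊆image = ker⊆image }
    where
    image⊆ker : ∀ v → IsZero G (apply G (augment r n B) (apply G (negOverId r n B) v))
    image⊆ker v i = trans (apply-augment _ i)
      (trans (∙-cong (apply-negOverId-↑ˡ B v i) (apply-cong B (apply-negOverId-↑ʳ B v) i)) (inverseˡ _))

    ker⊆image : ∀ y → IsZero G (apply G (augment r n B) y) → ∃ λ v → _≋_ G (apply G (negOverId r n B) v) y
    ker⊆image y y∈ker = v , ↑-elim r (λ j → apply G (negOverId r n B) v j ≈ y j)
      (λ i → trans (apply-negOverId-↑ˡ B v i) (sym (inverseˡ-unique _ _ (trans (sym (apply-augment y i)) (y∈ker i)))))
      (apply-negOverId-↑ʳ B v)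
      where
      v : Fin n → A
      v l = y (r ↑ʳ l)

  rowSections : (R : ZMatrix r n) → (∀ i → sum (λ l → R i l ℤ.* B i l) ≡ + 1) →
                RowSections (negOverId r n B) (negOverId r n R)
  rowSections R R·B≡1 = ↑-elim r _ bezout-row identity-row
    where
    negneg : ∀ x y → ℤ.- x ℤ.* ℤ.- y ≡ y ℤ.* x
    negneg = solve-∀

    bezout-row : ∀ i g → apply G (negOverId r n B) (λ a → negOverId r n R (i ↑ˡ n) a · g) (i ↑ˡ n) ≈ g
    bezout-row i g = begin
      ∑ (λ a → negOverId r n B (i ↑ˡ n) a · (negOverId r n R (i ↑ˡ n) a · g))
        ≡⟨ ≡.cong₂ (λ u w → ∑ (λ a → u a · (w a · g))) (negOverId-↑ˡ r n B i) (negOverId-↑ˡ r n R i) ⟩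
      ∑ (λ a → (ℤ.- B i a) · ((ℤ.- R i a) · g))
        ≈⟨ sumG-cong (λ a → trans (sym (intMul-* (ℤ.- B i a) (ℤ.- R i a) g))
                                  (reflexive (≡.cong (_· g) (negneg (B i a) (R i a))))) ⟩
      ∑ (λ a → (R i a ℤ.* B i a) · g)
        ≈⟨ sumG-intMulˡ (λ a → R i a ℤ.* B i a) g ⟩
      sum (λ a → R i a ℤ.* B i a) · g
        ≡⟨ ≡.cong (_· g) (R·B≡1 i) ⟩
      (+ 1) · g
        ≈⟨ identityʳ g ⟩
      g ∎

    identity-row : ∀ l g → apply G (negOverId r n B) (λ a → negOverId r n R (r ↑ʳ l) a · g) (r ↑ʳ l) ≈ g
    identity-row l g = begin
      ∑ (λ a → negOverId r n B (r ↑ʳ l) a · (negOverId r n R (r ↑ʳ l) a · g))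
        ≡⟨ ≡.cong₂ (λ u w → ∑ (λ a → u a · (w a · g))) (negOverId-↑ʳ r n B l) (negOverId-↑ʳ r n R l) ⟩
      ∑ (λ a → δ l a · (δ l a · g))
        ≈⟨ sumG-δ l (λ a → δ l a · g) ⟩
      δ l l · g
        ≡⟨ ≡.cong (_· g) (δ-diag l) ⟩
      (+ 1) · g
        ≈⟨ identityʳ g ⟩
      g ∎

proposition4p11 : (r n : ℕ) (B : ZMatrix r n) → IsSimple r n B →
    HasUniformRepresentation (augment r n B)
proposition4p11 r n B simple with IsSimple.cols simple
... | ℕ.s≤s (ℕ.s≤s _) = record
  { t     = T
  ; k     = K
  ; t-pos = ℕ.s≤s ℕ.z≤n
  ; k-pos = ℕ.s≤s ℕ.z≤n
  ; Ψ     = Ψ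
  ; rep   = λ G → representation G (augment r n B) (Augmented.kernelIsImage G B)
                    (negOverId r n R) (Augmented.rowSections G B R R·B≡1) zero
  }
  where
  open Construction (negOverId r n B)
  R : ZMatrix r n
  R i = proj₁ (gcdRow-bezout (B i))
  R·B≡1 : ∀ i → sum (λ l → R i l ℤ.* B i l) ≡ + 1
  R·B≡1 i = ≡.trans (proj₂ (gcdRow-bezout (B i))) (≡.cong +_ (IsSimple.gcd1 simple i))
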